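{- Let $n\ge 2$ and $i,j$ be integers with $1\le i<j\le n$. Let $W_1$ be the $2n\times 2n$ real symmetric matrix whose diagonal entries are $-3$ in positions $(2i,2i)$ and $(2j,2j)$ and $-2$ in all other diagonal positions, whose entries in positions $(k,k+1)$ and $(k+1,k)$ are $1$ for $1\le k\le 2n-1$, whose entries in positions $(1,2n)$ and $(2n,1)$ are $1$, and whose all other entries are $0$. Then $\det(W_1)=4n+8ij-4n(i-j)-4(i^2+j^2)$. -}

module Defs where

open import Data.Nat as ℕ using (ℕ; zero; suc)
open import Data.Integer using (ℤ; +_; _-_; _*_; -_)
open import Data.Fin using (Fin; zero; suc; toℕ; punchIn)
open import Data.Bool using (Bool; if_then_else_; _∨_)
open import Relation.Nullary.Decidable using (⌊_⌋)

Matrix : ℕ → Set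
Matrix n = Fin n → Fin n → ℤ

altSum : ∀ {n} → (Fin n → ℤ) → ℤ
altSum {zero}  f = + 0
altSum {suc n} f = f zero - altSum (λ k → f (suc k))

minor : ∀ {n} → Matrix (suc n) → Fin (suc n) → Matrix n
minor M k r c = M (suc r) (punchIn k c)

det : ∀ {n} → Matrix n → ℤ
det {zero}  M = + 1
det {suc n} M = altSum (λ k → M zero k * det (minor M k))

-- Entry (a , b) (1-based indices) of W₁ for parameters N = 2n, i, j.
W₁-entry : (N i j a b : ℕ) → ℤ
W₁-entry N i j a b =
  if ⌊ a ℕ.≟ b ⌋
    then (if ⌊ a ℕ.≟ 2 ℕ.* i ⌋ ∨ ⌊ a ℕ.≟ 2 ℕ.* j ⌋ then - (+ 3) else - (+ 2))
    else (if ⌊ suc a ℕ.≟ b ⌋ ∨ ⌊ suc b ℕ.≟ a ⌋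
             ∨ (⌊ a ℕ.≟ 1 ⌋ Data.Bool.∧ ⌊ b ℕ.≟ N ⌋)
             ∨ (⌊ a ℕ.≟ N ⌋ Data.Bool.∧ ⌊ b ℕ.≟ 1 ⌋)
            then + 1 else + 0)

W₁ : (n i j : ℕ) → Matrix (2 ℕ.* n)
W₁ n i j p q = W₁-entry (2 ℕ.* n) i j (suc (toℕ p)) (suc (toℕ q))

module Submission where

-- W₁ is a periodic tridiagonal matrix: diagonal d, unit off-diagonals and unit corners. Expanding
-- along the first row expresses its determinant through continuants K, the determinants of ordinary
-- tridiagonal matrices:  det W₁ = K(d₀ … d_{N−1}) − K(d₁ … d_{N−2}) + 2(−1)^{N+1}.  The continuant
-- obeys K(f₀ f₁ …) = f₀ K(f₁ …) − K(f₂ …), negating every entry multiplies K of length k by (−1)^k,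
-- and for the sequence 2 … 2 with 3 at the 0-based positions a < b ≤ k induction gives
--   K = (k+1) + (a+1)(k−a) + (b+1)(k−b) + (a+1)(b−a)(k−b).
-- With N = 2n, a = 2i−1, b = 2j−1 (and a−1, b−1 for the shorter continuant) this is the formula.

open import Data.Bool using (true; false; if_then_else_; _∨_)
open import Data.Bool.Properties using (∨-identityʳ; ∧-identityʳ; ∧-zeroʳ)
open import Data.Fin using (Fin; zero; suc; toℕ; fromℕ; punchIn)
import Data.Fin.Properties as Fin
open import Data.Integer using (ℤ; +_; _+_; _-_; _*_; -_)
import Data.Integer.Properties as ℤ
open import Data.Integer.Tactic.RingSolver using (solve-∀)
open import Data.Nat as ℕ using (ℕ; zero; suc; _≡ᵇ_; _≤_; _<_; z≤n; s≤s)
import Data.Nat.Properties as ℕ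
import Data.Nat.Tactic.RingSolver as ℕ-Solver
open import Relation.Binary.PropositionalEquality
open import Relation.Nullary.Decidable using (isYes≗does)

open import Defs

-- Laplace expansion

sign : ℕ → ℤ
sign zero    = + 1
sign (suc k) = - sign k

sign-even : ∀ n → sign (n ℕ.+ n) ≡ + 1
sign-even zero    = refl
sign-even (suc n) = begin
  sign (suc (n ℕ.+ suc n))   ≡⟨ cong (λ k → sign (suc k)) (ℕ.+-suc n n) ⟩
  - - sign (n ℕ.+ n)         ≡⟨ ℤ.neg-involutive (sign (n ℕ.+ n)) ⟩
  sign (n ℕ.+ n)             ≡⟨ sign-even n ⟩
  + 1                        ∎
  where open ≡-Reasoning

altSum-cong : ∀ {n} {f g : Fin n → ℤ} → (∀ k → f k ≡ g k) → altSum f ≡ altSum g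
altSum-cong {zero}  eq = refl
altSum-cong {suc n} eq = cong₂ _-_ (eq zero) (altSum-cong (λ k → eq (suc k)))

altSum-zero : ∀ {n} {f : Fin n → ℤ} → (∀ k → f k ≡ + 0) → altSum f ≡ + 0
altSum-zero {zero}  eq = refl
altSum-zero {suc n} eq = cong₂ _-_ (eq zero) (altSum-zero (λ k → eq (suc k)))

altSum-scale : ∀ {n} (a : ℤ) (f : Fin n → ℤ) → altSum (λ k → a * f k) ≡ a * altSum f
altSum-scale {zero}  a f = sym (ℤ.*-zeroʳ a)
altSum-scale {suc n} a f = begin
  a * f zero - altSum (λ k → a * f (suc k))
    ≡⟨ cong (λ y → a * f zero - y) (altSum-scale a (λ k → f (suc k))) ⟩
  a * f zero - a * altSum (λ k → f (suc k))
    ≡⟨ factor a (f zero) (altSum (λ k → f (suc k))) ⟩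
  a * (f zero - altSum (λ k → f (suc k))) ∎
  where
  open ≡-Reasoning
  factor : ∀ a x y → a * x - a * y ≡ a * (x - y)
  factor = solve-∀

altSum-last : ∀ t (f : ℕ → ℤ) → (∀ (p : Fin t) → f (toℕ p) ≡ + 0) →
  altSum {suc t} (λ p → f (toℕ p)) ≡ sign t * f t
altSum-last zero    f eq = simplify (f 0)
  where
  simplify : ∀ x → x - + 0 ≡ + 1 * x
  simplify = solve-∀
altSum-last (suc t) f eq = begin
  f 0 - altSum {suc t} (λ p → f (suc (toℕ p)))
    ≡⟨ cong₂ _-_ (eq zero) (altSum-last t (λ p → f (suc p)) (λ p → eq (suc p))) ⟩
  + 0 - sign t * f (suc t)
    ≡⟨ simplify (sign t) (f (suc t)) ⟩
  - sign t * f (suc t) ∎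
  where
  open ≡-Reasoning
  simplify : ∀ s x → + 0 - s * x ≡ - s * x
  simplify = solve-∀

det-cong : ∀ {n} {M N : Matrix n} → (∀ r c → M r c ≡ N r c) → det M ≡ det N
det-cong {zero}  eq = refl
det-cong {suc n} eq =
  altSum-cong (λ k → cong₂ _*_ (eq zero k) (det-cong (λ r c → eq (suc r) (punchIn k c))))

det-zeroColumn : ∀ {n} (M : Matrix (suc n)) → (∀ r → M r zero ≡ + 0) → det M ≡ + 0
det-zeroColumn {zero}  M eq = cong (λ x → x * + 1 - + 0) (eq zero)
det-zeroColumn {suc n} M eq = cong₂ _-_
  (cong (_* det (minor M zero)) (eq zero))
  (altSum-zero λ k → trans (cong (M zero (suc k) *_) (det-zeroColumn (minor M (suc k)) (λ r → eq (suc r))))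
                           (ℤ.*-zeroʳ (M zero (suc k))))

det-singleEntryColumn : ∀ {n} (M : Matrix (suc n)) (p : Fin (suc n)) →
  (∀ r → M (punchIn p r) zero ≡ + 0) →
  det M ≡ sign (toℕ p) * M p zero * det (λ r c → M (punchIn p r) (suc c))
det-singleEntryColumn {zero} M zero _ = simplify (M zero zero)
  where
  simplify : ∀ x → x * + 1 - + 0 ≡ + 1 * x * + 1
  simplify = solve-∀
det-singleEntryColumn {suc n} M zero eq = begin
  M zero zero * det (minor M zero) - altSum (λ k → M zero (suc k) * det (minor M (suc k)))
    ≡⟨ cong (λ y → M zero zero * det (minor M zero) - y) (altSum-zero λ k →
         trans (cong (M zero (suc k) *_) (det-zeroColumn (minor M (suc k)) eq)) (ℤ.*-zeroʳ (M zero (suc k)))) ⟩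
  M zero zero * det (minor M zero) - + 0
    ≡⟨ simplify (M zero zero) (det (minor M zero)) ⟩
  + 1 * M zero zero * det (minor M zero) ∎
  where
  open ≡-Reasoning
  simplify : ∀ x y → x * y - + 0 ≡ + 1 * x * y
  simplify = solve-∀
det-singleEntryColumn {suc n} M (suc q) eq = begin
  M zero zero * det (minor M zero) - altSum (λ k → M zero (suc k) * det (minor M (suc k)))
    ≡⟨ cong₂ (λ x y → x * det (minor M zero) - y) (eq zero) (altSum-cong λ k →
         cong (M zero (suc k) *_) (det-singleEntryColumn (minor M (suc k)) q (λ r → eq (suc r)))) ⟩
  + 0 * det (minor M zero) - altSum (λ k → M zero (suc k) * (s * m * D k))
    ≡⟨ cong (λ y → + 0 * det (minor M zero) - y) (altSum-cong λ k → swap (M zero (suc k)) (s * m) (D k)) ⟩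
  + 0 * det (minor M zero) - altSum (λ k → s * m * (M zero (suc k) * D k))
    ≡⟨ cong (λ y → + 0 * det (minor M zero) - y) (altSum-scale (s * m) (λ k → M zero (suc k) * D k)) ⟩
  + 0 * det (minor M zero) - s * m * altSum (λ k → M zero (suc k) * D k)
    ≡⟨ simplify (det (minor M zero)) s m (altSum (λ k → M zero (suc k) * D k)) ⟩
  - s * m * altSum (λ k → M zero (suc k) * D k) ∎
  where
  open ≡-Reasoning
  s = sign (toℕ q)
  m = M (suc q) zero
  D : Fin (suc n) → ℤ
  D k = det (λ r c → M (suc (punchIn q r)) (suc (punchIn k c)))
  swap : ∀ a b d → a * (b * d) ≡ b * (a * d)
  swap = solve-∀
  simplify : ∀ x s m y → + 0 * x - s * m * y ≡ - s * m * y
  simplify = solve-∀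

punchInℕ : ℕ → ℕ → ℕ
punchInℕ zero    c       = suc c
punchInℕ (suc p) zero    = zero
punchInℕ (suc p) (suc c) = suc (punchInℕ p c)

toℕ-punchIn : ∀ {n} (p : Fin (suc n)) (c : Fin n) → toℕ (punchIn p c) ≡ punchInℕ (toℕ p) (toℕ c)
toℕ-punchIn zero    c       = refl
toℕ-punchIn (suc p) zero    = refl
toℕ-punchIn (suc p) (suc c) = cong suc (toℕ-punchIn p c)

punchInℕ-toℕ : ∀ {n} (c : Fin n) → punchInℕ n (toℕ c) ≡ toℕ c
punchInℕ-toℕ zero    = refl
punchInℕ-toℕ (suc c) = cong suc (punchInℕ-toℕ c)

toℕ-punchIn-fromℕ : ∀ {n} (c : Fin n) → toℕ (punchIn (fromℕ n) c) ≡ toℕ c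
toℕ-punchIn-fromℕ {n} c = trans (toℕ-punchIn (fromℕ n) c)
  (trans (cong (λ p → punchInℕ p (toℕ c)) (Fin.toℕ-fromℕ n)) (punchInℕ-toℕ c))

leading : (k : ℕ) → (ℕ → ℕ → ℤ) → Matrix k
leading k G r c = G (toℕ r) (toℕ c)

minorℕ : ℕ → (ℕ → ℕ → ℤ) → ℕ → ℕ → ℤ
minorℕ p G r c = G (suc r) (punchInℕ p c)

minorDet : ℕ → (ℕ → ℕ → ℤ) → ℕ → ℤ
minorDet k G p = det (leading k (minorℕ p G))

det-leading : ∀ k G →
  det (leading (suc k) G) ≡ altSum {suc k} (λ p → G 0 (toℕ p) * minorDet k G (toℕ p))
det-leading k G = altSum-cong λ p → cong (G 0 (toℕ p) *_)
  (det-cong {M = minor (leading (suc k) G) p} {N = leading k (minorℕ (toℕ p) G)}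
    λ r c → cong (G (suc (toℕ r))) (toℕ-punchIn p c))

det-leading-twoEntryRow : ∀ k G → (∀ c → G 0 (2 ℕ.+ c) ≡ + 0) →
  det (leading (2 ℕ.+ k) G) ≡ G 0 0 * minorDet (suc k) G 0 - G 0 1 * minorDet (suc k) G 1
det-leading-twoEntryRow k G eq = begin
  det (leading (2 ℕ.+ k) G)
    ≡⟨ det-leading (suc k) G ⟩
  G 0 0 * D 0 - (G 0 1 * D 1 - altSum {k} (λ p → G 0 (2 ℕ.+ toℕ p) * D (2 ℕ.+ toℕ p)))
    ≡⟨ cong (λ y → G 0 0 * D 0 - (G 0 1 * D 1 - y))
         (altSum-zero {k} λ p → cong (_* D (2 ℕ.+ toℕ p)) (eq (toℕ p))) ⟩
  G 0 0 * D 0 - (G 0 1 * D 1 - + 0)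
    ≡⟨ simplify (G 0 0 * D 0) (G 0 1 * D 1) ⟩
  G 0 0 * D 0 - G 0 1 * D 1 ∎
  where
  open ≡-Reasoning
  D = minorDet (suc k) G
  simplify : ∀ x y → x - (y - + 0) ≡ x - y
  simplify = solve-∀

det-leading-threeEntryRow : ∀ k G → (∀ c → G 0 (3 ℕ.+ c) ≡ + 0) →
  det (leading (3 ℕ.+ k) G)
    ≡ G 0 0 * minorDet (2 ℕ.+ k) G 0 - G 0 1 * minorDet (2 ℕ.+ k) G 1 + G 0 2 * minorDet (2 ℕ.+ k) G 2
det-leading-threeEntryRow k G eq = begin
  det (leading (3 ℕ.+ k) G)
    ≡⟨ det-leading (2 ℕ.+ k) G ⟩
  G 0 0 * D 0 - (G 0 1 * D 1 - (G 0 2 * D 2 - altSum {k} (λ p → G 0 (3 ℕ.+ toℕ p) * D (3 ℕ.+ toℕ p))))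
    ≡⟨ cong (λ y → G 0 0 * D 0 - (G 0 1 * D 1 - (G 0 2 * D 2 - y)))
         (altSum-zero {k} λ p → cong (_* D (3 ℕ.+ toℕ p)) (eq (toℕ p))) ⟩
  G 0 0 * D 0 - (G 0 1 * D 1 - (G 0 2 * D 2 - + 0))
    ≡⟨ simplify (G 0 0 * D 0) (G 0 1 * D 1) (G 0 2 * D 2) ⟩
  G 0 0 * D 0 - G 0 1 * D 1 + G 0 2 * D 2 ∎
  where
  open ≡-Reasoning
  D = minorDet (2 ℕ.+ k) G
  simplify : ∀ x y z → x - (y - (z - + 0)) ≡ x - y + z
  simplify = solve-∀

det-leading-firstRow : ∀ k G → (∀ c → G 0 (suc c) ≡ + 0) →
  det (leading (suc k) G) ≡ G 0 0 * det (leading k (λ r c → G (suc r) (suc c)))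
det-leading-firstRow k G eq = begin
  G 0 0 * D - altSum {k} (λ p → G 0 (suc (toℕ p)) * det (minor (leading (suc k) G) (suc p)))
    ≡⟨ cong (λ y → G 0 0 * D - y)
         (altSum-zero λ p → cong (_* det (minor (leading (suc k) G) (suc p))) (eq (toℕ p))) ⟩
  G 0 0 * D - + 0
    ≡⟨ ℤ.+-identityʳ (G 0 0 * D) ⟩
  G 0 0 * D ∎
  where
  open ≡-Reasoning
  D = det (leading k (λ r c → G (suc r) (suc c)))

det-leading-firstColumn : ∀ k G → (∀ r → G (suc r) 0 ≡ + 0) →
  det (leading (suc k) G) ≡ G 0 0 * det (leading k (λ r c → G (suc r) (suc c)))
det-leading-firstColumn k G eq =
  trans (det-singleEntryColumn (leading (suc k) G) zero (λ r → eq (toℕ r)))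
        (cong (_* det (leading k (λ r c → G (suc r) (suc c)))) (ℤ.*-identityˡ (G 0 0)))

det-leading-lastColumn : ∀ k G → (∀ (r : Fin k) → G (toℕ r) 0 ≡ + 0) →
  det (leading (suc k) G) ≡ sign k * G k 0 * det (leading k (λ r c → G r (suc c)))
det-leading-lastColumn k G eq = begin
  det (leading (suc k) G)
    ≡⟨ det-singleEntryColumn (leading (suc k) G) (fromℕ k)
         (λ r → trans (cong (λ x → G x 0) (toℕ-punchIn-fromℕ r)) (eq r)) ⟩
  sign (toℕ (fromℕ k)) * G (toℕ (fromℕ k)) 0 * det (λ r c → G (toℕ (punchIn (fromℕ k) r)) (suc (toℕ c)))
    ≡⟨ cong₂ (λ x D → sign x * G x 0 * D) (Fin.toℕ-fromℕ k)
         (det-cong {k} λ r c → cong (λ x → G x (suc (toℕ c))) (toℕ-punchIn-fromℕ r)) ⟩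
  sign k * G k 0 * det (leading k (λ r c → G r (suc c))) ∎
  where open ≡-Reasoning

-- Tridiagonal matrices and continuants

shift : (ℕ → ℤ) → ℕ → ℤ
shift f p = f (suc p)

tridiagonal : (ℕ → ℤ) → ℕ → ℕ → ℤ
tridiagonal f zero          zero          = f zero
tridiagonal f zero          (suc zero)    = + 1
tridiagonal f zero          (suc (suc c)) = + 0
tridiagonal f (suc r)       (suc c)       = tridiagonal (shift f) r c
tridiagonal f (suc zero)    zero          = + 1
tridiagonal f (suc (suc r)) zero          = + 0

tridiagonal-entry : ∀ f r c →
  tridiagonal f r c ≡ (if r ≡ᵇ c then f r else if (suc r ≡ᵇ c) ∨ (suc c ≡ᵇ r) then + 1 else + 0)
tridiagonal-entry f zero          zero          = refl
tridiagonal-entry f zero          (suc zero)    = refl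
tridiagonal-entry f zero          (suc (suc c)) = refl
tridiagonal-entry f (suc r)       (suc c)       = tridiagonal-entry (shift f) r c
tridiagonal-entry f (suc zero)    zero          = refl
tridiagonal-entry f (suc (suc r)) zero          = refl

continuant : (ℕ → ℤ) → ℕ → ℤ
continuant f zero          = + 1
continuant f (suc zero)    = f zero
continuant f (suc (suc k)) = f zero * continuant (shift f) (suc k) - continuant (shift (shift f)) k

det-tridiagonal : ∀ k f → det (leading k (tridiagonal f)) ≡ continuant f k
det-tridiagonal zero          f = refl
det-tridiagonal (suc zero)    f = simplify (f zero)
  where
  simplify : ∀ x → x * + 1 - + 0 ≡ x
  simplify = solve-∀
det-tridiagonal (suc (suc k)) f = begin
  det (leading (2 ℕ.+ k) (tridiagonal f))
    ≡⟨ det-leading-twoEntryRow k (tridiagonal f) (λ _ → refl) ⟩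
  f 0 * det (leading (suc k) (tridiagonal (shift f))) - + 1 * minorDet (suc k) (tridiagonal f) 1
    ≡⟨ cong₂ (λ x y → f 0 * x - y) (det-tridiagonal (suc k) (shift f)) (ℤ.*-identityˡ _) ⟩
  f 0 * continuant (shift f) (suc k) - minorDet (suc k) (tridiagonal f) 1
    ≡⟨ cong (λ y → f 0 * continuant (shift f) (suc k) - y) (begin
         minorDet (suc k) (tridiagonal f) 1
           ≡⟨ det-leading-firstColumn k (minorℕ 1 (tridiagonal f)) (λ _ → refl) ⟩
         + 1 * det (leading k (tridiagonal (shift (shift f))))
           ≡⟨ ℤ.*-identityˡ _ ⟩
         det (leading k (tridiagonal (shift (shift f))))
           ≡⟨ det-tridiagonal k (shift (shift f)) ⟩
         continuant (shift (shift f)) k ∎) ⟩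
  continuant f (2 ℕ.+ k) ∎
  where open ≡-Reasoning

det-tridiagonal-dropColumn : ∀ k f → det (leading k (λ r c → tridiagonal f r (suc c))) ≡ + 1
det-tridiagonal-dropColumn zero    f = refl
det-tridiagonal-dropColumn (suc k) f =
  trans (det-leading-firstRow k (λ r c → tridiagonal f r (suc c)) (λ _ → refl))
        (trans (ℤ.*-identityˡ _) (det-tridiagonal-dropColumn k (shift f)))

det-tridiagonal-dropRow : ∀ k f → det (leading k (λ r c → tridiagonal f (suc r) c)) ≡ + 1
det-tridiagonal-dropRow zero    f = refl
det-tridiagonal-dropRow (suc k) f =
  trans (det-leading-firstColumn k (λ r c → tridiagonal f (suc r) c) (λ _ → refl))
        (trans (ℤ.*-identityˡ _) (det-tridiagonal-dropRow k (shift f)))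

continuant-cong : ∀ {f g} → (∀ p → f p ≡ g p) → ∀ k → continuant f k ≡ continuant g k
continuant-cong eq zero          = refl
continuant-cong eq (suc zero)    = eq 0
continuant-cong eq (suc (suc k)) = cong₂ _-_
  (cong₂ _*_ (eq 0) (continuant-cong (λ p → eq (suc p)) (suc k)))
  (continuant-cong (λ p → eq (suc (suc p))) k)

continuant-neg : ∀ f k → continuant (λ p → - f p) k ≡ sign k * continuant f k
continuant-neg f zero          = refl
continuant-neg f (suc zero)    = sym (ℤ.-1*i≡-i (f 0))
continuant-neg f (suc (suc k)) = trans
  (cong₂ (λ x y → - f 0 * x - y) (continuant-neg (shift f) (suc k)) (continuant-neg (shift (shift f)) k))
  (step (f 0) (sign k) (continuant (shift f) (suc k)) (continuant (shift (shift f)) k))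
  where
  step : ∀ a s x y → - a * (- s * x) - s * y ≡ - - s * (a * x - y)
  step = solve-∀

-- The periodic tridiagonal matrix

δ : ℕ → ℕ → ℤ
δ a b = if a ≡ᵇ b then + 1 else + 0

δ-refl : ∀ k → δ k k ≡ + 1
δ-refl zero    = refl
δ-refl (suc k) = δ-refl k

δ-toℕ : ∀ {k} (r : Fin k) → δ (toℕ r) k ≡ + 0
δ-toℕ zero    = refl
δ-toℕ (suc r) = δ-toℕ r

-- Of size N: the δ entries are the corners (0, N − 1) and (N − 1, 0).
periodicTridiagonal : ℕ → (ℕ → ℤ) → ℕ → ℕ → ℤ
periodicTridiagonal N d zero          zero          = d zero
periodicTridiagonal N d zero          (suc zero)    = + 1
periodicTridiagonal N d zero          (suc (suc c)) = δ (3 ℕ.+ c) N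
periodicTridiagonal N d (suc r)       (suc c)       = tridiagonal (shift d) r c
periodicTridiagonal N d (suc zero)    zero          = + 1
periodicTridiagonal N d (suc (suc r)) zero          = δ (3 ℕ.+ r) N

module _ (m : ℕ) (d : ℕ → ℤ) where
  private
    P = periodicTridiagonal (4 ℕ.+ m) d
    s = sign (suc m)
    open ≡-Reasoning

  det-periodicTridiagonal-minor₁ : minorDet (3 ℕ.+ m) P 1 ≡ continuant (shift (shift d)) (2 ℕ.+ m) - s
  det-periodicTridiagonal-minor₁ = begin
    minorDet (3 ℕ.+ m) P 1
      ≡⟨ det-leading-twoEntryRow (suc m) (minorℕ 1 P) (λ _ → refl) ⟩
    + 1 * det (leading (2 ℕ.+ m) (tridiagonal (shift (shift d)))) - + 1 * minorDet (2 ℕ.+ m) (minorℕ 1 P) 1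
      ≡⟨ cong₂ (λ x y → + 1 * x - + 1 * y) (det-tridiagonal (2 ℕ.+ m) (shift (shift d)))
           (det-leading-lastColumn (suc m) (minorℕ 1 (minorℕ 1 P)) δ-toℕ) ⟩
    + 1 * K₂ - + 1 * (s * δ (4 ℕ.+ m) (4 ℕ.+ m)
                       * det (leading (suc m) (λ r c → tridiagonal (shift (shift d)) r (suc c))))
      ≡⟨ cong₂ (λ x y → + 1 * K₂ - + 1 * (s * x * y))
           (δ-refl (4 ℕ.+ m)) (det-tridiagonal-dropColumn (suc m) (shift (shift d))) ⟩
    + 1 * K₂ - + 1 * (s * + 1 * + 1)
      ≡⟨ simplify K₂ s ⟩
    K₂ - s ∎
    where
    K₂ = continuant (shift (shift d)) (2 ℕ.+ m)
    simplify : ∀ x s → + 1 * x - + 1 * (s * + 1 * + 1) ≡ x - s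
    simplify = solve-∀

  det-periodicTridiagonal-minorLast :
    minorDet (3 ℕ.+ m) P (3 ℕ.+ m) ≡ + 1 - s * continuant (shift d) (2 ℕ.+ m)
  det-periodicTridiagonal-minorLast = begin
    minorDet (3 ℕ.+ m) P (3 ℕ.+ m)
      ≡⟨ det-cong {3 ℕ.+ m} (λ r c → cong (P (suc (toℕ r))) (punchInℕ-toℕ c)) ⟩
    det (leading (3 ℕ.+ m) L)
      ≡⟨ det-leading-threeEntryRow m L (λ _ → refl) ⟩
    + 1 * D 0 - d 1 * D 1 + + 1 * D 2
      ≡⟨ cong₂ (λ x y → + 1 * x - d 1 * D 1 + + 1 * y)
           (det-tridiagonal-dropRow (2 ℕ.+ m) (shift d))
           (det-leading-lastColumn (suc m) (minorℕ 2 L) δ-toℕ) ⟩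
    + 1 * + 1 - d 1 * D 1 + + 1 * (s * δ₄ * det (leading (suc m) (λ r c → L (suc r) (punchInℕ 2 (suc c)))))
      ≡⟨ cong₂ (λ x y → + 1 * + 1 - d 1 * x + + 1 * (s * δ₄ * y))
           (det-leading-lastColumn (suc m) (minorℕ 1 L) δ-toℕ)
           (det-leading-firstColumn m (λ r c → L (suc r) (punchInℕ 2 (suc c))) (λ _ → refl)) ⟩
    + 1 * + 1 - d 1 * (s * δ₄ * det (leading (suc m) (tridiagonal (shift (shift d)))))
      + + 1 * (s * δ₄ * (+ 1 * det (leading m (tridiagonal (shift (shift (shift d)))))))
      ≡⟨ cong₂ (λ x y → + 1 * + 1 - d 1 * (s * δ₄ * x) + + 1 * (s * δ₄ * (+ 1 * y)))
           (det-tridiagonal (suc m) (shift (shift d))) (det-tridiagonal m (shift (shift (shift d)))) ⟩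
    + 1 * + 1 - d 1 * (s * δ₄ * K₂) + + 1 * (s * δ₄ * (+ 1 * K₃))
      ≡⟨ cong (λ x → + 1 * + 1 - d 1 * (s * x * K₂) + + 1 * (s * x * (+ 1 * K₃))) (δ-refl (4 ℕ.+ m)) ⟩
    + 1 * + 1 - d 1 * (s * + 1 * K₂) + + 1 * (s * + 1 * (+ 1 * K₃))
      ≡⟨ simplify (d 1) s K₂ K₃ ⟩
    + 1 - s * continuant (shift d) (2 ℕ.+ m) ∎
    where
    L = λ r c → P (suc r) c
    D = minorDet (2 ℕ.+ m) L
    δ₄ = δ (4 ℕ.+ m) (4 ℕ.+ m)
    K₂ = continuant (shift (shift d)) (suc m)
    K₃ = continuant (shift (shift (shift d))) m
    simplify : ∀ a s x y → + 1 * + 1 - a * (s * + 1 * x) + + 1 * (s * + 1 * (+ 1 * y)) ≡ + 1 - s * (a * x - y)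
    simplify = solve-∀

  -- In row 0 only the columns 0, 1 and N − 1 are nonzero.
  det-periodicTridiagonal : det (leading (4 ℕ.+ m) P)
    ≡ continuant d (4 ℕ.+ m) + s + s - continuant (shift d) (2 ℕ.+ m)
  det-periodicTridiagonal = begin
    det (leading (4 ℕ.+ m) P)
      ≡⟨ det-leading (3 ℕ.+ m) P ⟩
    d 0 * D 0 - (+ 1 * D 1 - altSum {2 ℕ.+ m} (λ p → P 0 (2 ℕ.+ toℕ p) * D (2 ℕ.+ toℕ p)))
      ≡⟨ cong (λ y → d 0 * D 0 - (+ 1 * D 1 - y))
           (altSum-last (suc m) (λ p → P 0 (2 ℕ.+ p) * D (2 ℕ.+ p))
             (λ p → cong (_* D (2 ℕ.+ toℕ p)) (δ-toℕ p))) ⟩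
    d 0 * D 0 - (+ 1 * D 1 - s * (δ (4 ℕ.+ m) (4 ℕ.+ m) * D (3 ℕ.+ m)))
      ≡⟨ cong₂ (λ x y → d 0 * D 0 - (+ 1 * D 1 - s * (x * y)))
           (δ-refl (4 ℕ.+ m)) det-periodicTridiagonal-minorLast ⟩
    d 0 * D 0 - (+ 1 * D 1 - s * (+ 1 * (+ 1 - s * K₁)))
      ≡⟨ cong₂ (λ x y → d 0 * x - (+ 1 * y - s * (+ 1 * (+ 1 - s * K₁))))
           (det-tridiagonal (3 ℕ.+ m) (shift d)) det-periodicTridiagonal-minor₁ ⟩
    d 0 * continuant (shift d) (3 ℕ.+ m) - (+ 1 * (K₂ - s) - s * (+ 1 * (+ 1 - s * K₁)))
      ≡⟨ simplify (d 0) (continuant (shift d) (3 ℕ.+ m)) K₂ s K₁ ⟩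
    continuant d (4 ℕ.+ m) + s + s - s * s * K₁
      ≡⟨ cong (λ x → continuant d (4 ℕ.+ m) + s + s - x * K₁) (sign-square (suc m)) ⟩
    continuant d (4 ℕ.+ m) + s + s - + 1 * K₁
      ≡⟨ cong (λ x → continuant d (4 ℕ.+ m) + s + s - x) (ℤ.*-identityˡ K₁) ⟩
    continuant d (4 ℕ.+ m) + s + s - K₁ ∎
    where
    D = minorDet (3 ℕ.+ m) P
    K₁ = continuant (shift d) (2 ℕ.+ m)
    K₂ = continuant (shift (shift d)) (2 ℕ.+ m)
    simplify : ∀ a x y s z → a * x - (+ 1 * (y - s) - s * (+ 1 * (+ 1 - s * z))) ≡ a * x - y + s + s - s * s * z
    simplify = solve-∀
    sign-square : ∀ k → sign k * sign k ≡ + 1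
    sign-square zero    = refl
    sign-square (suc k) = trans (negate² (sign k)) (sign-square k)
      where
      negate² : ∀ s → - s * - s ≡ s * s
      negate² = solve-∀

-- Continuants of 2, …, 2 with entries 3

twos : ℕ → ℤ
twos _ = + 2

threeAt : ℕ → (ℕ → ℤ) → ℕ → ℤ
threeAt a f p = if p ≡ᵇ a then + 3 else f p

-- Inlined so that the ring solver sees the polynomials.
K₁ : ℤ → ℤ → ℤ
K₁ a k = k + + 1 + (a + + 1) * (k - a)
{-# INLINE K₁ #-}

K₂ : ℤ → ℤ → ℤ → ℤ
K₂ a b k = K₁ a k + (b + + 1) * (k - b) + (a + + 1) * (b - a) * (k - b)
{-# INLINE K₂ #-}

continuant-twos : ∀ k → continuant twos k ≡ + k + + 1
continuant-twos zero          = refl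
continuant-twos (suc zero)    = refl
continuant-twos (suc (suc k)) =
  trans (cong₂ (λ x y → + 2 * x - y) (continuant-twos (suc k)) (continuant-twos k)) (step (+ k))
  where
  step : ∀ k → + 2 * (+ 1 + k + + 1) - (k + + 1) ≡ + 2 + k + + 1
  step = solve-∀

continuant-threeAt : ∀ k a → a ≤ k → continuant (threeAt a twos) k ≡ K₁ (+ a) (+ k)
continuant-threeAt zero          zero          _ = refl
continuant-threeAt (suc zero)    zero          _ = refl
continuant-threeAt (suc zero)    (suc zero)    _ = refl
continuant-threeAt (suc zero)    (suc (suc a)) (s≤s ())
continuant-threeAt (suc (suc k)) zero          _ =
  trans (cong₂ (λ x y → + 3 * x - y) (continuant-twos (suc k)) (continuant-twos k)) (step (+ k))
  where
  step : ∀ k → + 3 * (+ 1 + k + + 1) - (k + + 1) ≡ K₁ (+ 0) (+ 2 + k)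
  step = solve-∀
continuant-threeAt (suc (suc k)) (suc zero)    _ =
  trans (cong₂ (λ x y → + 2 * x - y) (continuant-threeAt (suc k) zero z≤n) (continuant-twos k)) (step (+ k))
  where
  step : ∀ k → + 2 * K₁ (+ 0) (+ 1 + k) - (k + + 1) ≡ K₁ (+ 1) (+ 2 + k)
  step = solve-∀
continuant-threeAt (suc (suc k)) (suc (suc a)) (s≤s (s≤s a≤k)) =
  trans (cong₂ (λ x y → + 2 * x - y) (continuant-threeAt (suc k) (suc a) (s≤s a≤k)) (continuant-threeAt k a a≤k))
        (step (+ a) (+ k))
  where
  step : ∀ a k → + 2 * K₁ (+ 1 + a) (+ 1 + k) - K₁ a k ≡ K₁ (+ 2 + a) (+ 2 + k)
  step = solve-∀

continuant-threeAt₂ : ∀ k a b → a < b → b ≤ k →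
  continuant (threeAt a (threeAt b twos)) k ≡ K₂ (+ a) (+ b) (+ k)
continuant-threeAt₂ (suc zero)    zero          (suc zero)    _ _ = refl
continuant-threeAt₂ (suc zero)    zero          (suc (suc b)) _ (s≤s ())
continuant-threeAt₂ (suc k)       (suc zero)    (suc zero)    (s≤s ()) _
continuant-threeAt₂ (suc (suc k)) zero          (suc zero)    _ _ =
  trans (cong₂ (λ x y → + 3 * x - y) (continuant-threeAt (suc k) zero z≤n) (continuant-twos k)) (step (+ k))
  where
  step : ∀ k → + 3 * K₁ (+ 0) (+ 1 + k) - (k + + 1) ≡ K₂ (+ 0) (+ 1) (+ 2 + k)
  step = solve-∀
continuant-threeAt₂ (suc (suc k)) zero          (suc (suc b)) _ (s≤s (s≤s b≤k)) =
  trans (cong₂ (λ x y → + 3 * x - y) (continuant-threeAt (suc k) (suc b) (s≤s b≤k)) (continuant-threeAt k b b≤k))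
        (step (+ b) (+ k))
  where
  step : ∀ b k → + 3 * K₁ (+ 1 + b) (+ 1 + k) - K₁ b k ≡ K₂ (+ 0) (+ 2 + b) (+ 2 + k)
  step = solve-∀
continuant-threeAt₂ (suc (suc k)) (suc zero)    (suc (suc b)) _ (s≤s (s≤s b≤k)) =
  trans (cong₂ (λ x y → + 2 * x - y)
          (continuant-threeAt₂ (suc k) zero (suc b) (s≤s z≤n) (s≤s b≤k)) (continuant-threeAt k b b≤k))
        (step (+ b) (+ k))
  where
  step : ∀ b k → + 2 * K₂ (+ 0) (+ 1 + b) (+ 1 + k) - K₁ b k ≡ K₂ (+ 1) (+ 2 + b) (+ 2 + k)
  step = solve-∀
continuant-threeAt₂ (suc (suc k)) (suc (suc a)) (suc (suc b)) (s≤s (s≤s a<b)) (s≤s (s≤s b≤k)) =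
  trans (cong₂ (λ x y → + 2 * x - y)
          (continuant-threeAt₂ (suc k) (suc a) (suc b) (s≤s a<b) (s≤s b≤k)) (continuant-threeAt₂ k a b a<b b≤k))
        (step (+ a) (+ b) (+ k))
  where
  step : ∀ a b k → + 2 * K₂ (+ 1 + a) (+ 1 + b) (+ 1 + k) - K₂ a b k ≡ K₂ (+ 2 + a) (+ 2 + b) (+ 2 + k)
  step = solve-∀

continuant-negThreeAt₂ : ∀ k a b → a < b → b ≤ k → sign k ≡ + 1 →
  continuant (λ p → - threeAt a (threeAt b twos) p) k ≡ K₂ (+ a) (+ b) (+ k)
continuant-negThreeAt₂ k a b a<b b≤k even = begin
  continuant (λ p → - threeAt a (threeAt b twos) p) k
    ≡⟨ continuant-neg (threeAt a (threeAt b twos)) k ⟩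
  sign k * continuant (threeAt a (threeAt b twos)) k
    ≡⟨ cong₂ _*_ even (continuant-threeAt₂ k a b a<b b≤k) ⟩
  + 1 * K₂ (+ a) (+ b) (+ k)
    ≡⟨ ℤ.*-identityˡ _ ⟩
  K₂ (+ a) (+ b) (+ k) ∎
  where open ≡-Reasoning

W₁-diagonal : ℕ → ℕ → ℕ → ℤ
W₁-diagonal i j p = if (suc p ≡ᵇ 2 ℕ.* i) ∨ (suc p ≡ᵇ 2 ℕ.* j) then - (+ 3) else - (+ 2)

-- Rewriting ⌊ m ≟ n ⌋ to m ≡ᵇ n lets the comparisons compute on successors.
W₁-entry-periodicTridiagonal : ∀ m i j r c →
  W₁-entry (2 ℕ.+ m) i j (suc r) (suc c) ≡ periodicTridiagonal (2 ℕ.+ m) (W₁-diagonal i j) r c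
W₁-entry-periodicTridiagonal m i j zero zero
  rewrite isYes≗does (1 ℕ.≟ 2 ℕ.* i) | isYes≗does (1 ℕ.≟ 2 ℕ.* j) = refl
W₁-entry-periodicTridiagonal m i j zero (suc zero) = refl
W₁-entry-periodicTridiagonal m i j zero (suc (suc c))
  rewrite isYes≗does (3 ℕ.+ c ℕ.≟ 2 ℕ.+ m) | ∨-identityʳ (3 ℕ.+ c ≡ᵇ 2 ℕ.+ m) = refl
W₁-entry-periodicTridiagonal m i j (suc zero) zero = refl
W₁-entry-periodicTridiagonal m i j (suc (suc r)) zero
  rewrite isYes≗does (3 ℕ.+ r ℕ.≟ 2 ℕ.+ m) | ∧-identityʳ (3 ℕ.+ r ≡ᵇ 2 ℕ.+ m) = refl
W₁-entry-periodicTridiagonal m i j (suc r) (suc c)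
  rewrite isYes≗does (2 ℕ.+ r ℕ.≟ 2 ℕ.+ c) | isYes≗does (2 ℕ.+ r ℕ.≟ 2 ℕ.* i) | isYes≗does (2 ℕ.+ r ℕ.≟ 2 ℕ.* j)
        | isYes≗does (3 ℕ.+ r ℕ.≟ 2 ℕ.+ c) | isYes≗does (3 ℕ.+ c ℕ.≟ 2 ℕ.+ r) | isYes≗does (2 ℕ.+ r ℕ.≟ 2 ℕ.+ m)
        | ∧-zeroʳ (2 ℕ.+ r ≡ᵇ 2 ℕ.+ m) | ∨-identityʳ (suc c ≡ᵇ r)
  = sym (tridiagonal-entry (shift (W₁-diagonal i j)) r c)

det-W₁ : ∀ n i j →
  det (W₁ (2 ℕ.+ n) i j)
    ≡ det (leading (4 ℕ.+ (n ℕ.+ n)) (periodicTridiagonal (4 ℕ.+ (n ℕ.+ n)) (W₁-diagonal i j)))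
det-W₁ n i j = trans
  (det-cong {M = W₁ (2 ℕ.+ n) i j} {N = leading (2 ℕ.* (2 ℕ.+ n)) (P (2 ℕ.* (2 ℕ.+ n)))}
    (λ r c → W₁-entry-periodicTridiagonal _ i j (toℕ r) (toℕ c)))
  (cong (λ N → det (leading N (P N))) (size n))
  where
  P = λ N → periodicTridiagonal N (W₁-diagonal i j)
  size : ∀ n → 2 ℕ.* (2 ℕ.+ n) ≡ 4 ℕ.+ (n ℕ.+ n)
  size = ℕ-Solver.solve-∀

double-suc : ∀ k → 2 ℕ.* suc k ≡ 2 ℕ.+ (k ℕ.+ k)
double-suc = ℕ-Solver.solve-∀

-- The paper's i, j are suc i, suc j here, so the 3s sit at the 0-based positions 2i + 1 and 2j + 1.
W₁-diagonal-threeAt : ∀ i j p →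
  W₁-diagonal (suc i) (suc j) p ≡ - threeAt (suc (i ℕ.+ i)) (threeAt (suc (j ℕ.+ j)) twos) p
W₁-diagonal-threeAt i j p = trans
  (cong₂ (λ x y → if x ∨ y then - (+ 3) else - (+ 2))
    (cong (suc p ≡ᵇ_) (double-suc i)) (cong (suc p ≡ᵇ_) (double-suc j)))
  (select (p ≡ᵇ suc (i ℕ.+ i)) (p ≡ᵇ suc (j ℕ.+ j)))
  where
  select : ∀ x y → (if x ∨ y then - (+ 3) else - (+ 2)) ≡ - (if x then + 3 else if y then + 3 else + 2)
  select true  _     = refl
  select false true  = refl
  select false false = refl

module _ (n i j : ℕ) (i<j : i < j) (j≤1+n : j ≤ suc n) where
  private
    i+i<j+j : i ℕ.+ i < j ℕ.+ j
    i+i<j+j = ℕ.+-mono-< i<j i<j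
    j+j≤2+n+n : j ℕ.+ j ≤ 2 ℕ.+ (n ℕ.+ n)
    j+j≤2+n+n = ℕ.≤-trans (ℕ.+-mono-≤ j≤1+n j≤1+n) (ℕ.≤-reflexive (cong suc (ℕ.+-suc n n)))
    sign-even₂ : sign (2 ℕ.+ (n ℕ.+ n)) ≡ + 1
    sign-even₂ = trans (ℤ.neg-involutive (sign (n ℕ.+ n))) (sign-even n)

  continuant-W₁-diagonal : continuant (W₁-diagonal (suc i) (suc j)) (4 ℕ.+ (n ℕ.+ n))
    ≡ K₂ (+ suc (i ℕ.+ i)) (+ suc (j ℕ.+ j)) (+ (4 ℕ.+ (n ℕ.+ n)))
  continuant-W₁-diagonal =
    trans (continuant-cong (W₁-diagonal-threeAt i j) (4 ℕ.+ (n ℕ.+ n)))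
          (continuant-negThreeAt₂ _ _ _ (s≤s i+i<j+j) (s≤s (ℕ.m≤n⇒m≤1+n j+j≤2+n+n))
            (trans (ℤ.neg-involutive (sign (2 ℕ.+ (n ℕ.+ n)))) sign-even₂))

  continuant-shift-W₁-diagonal : continuant (shift (W₁-diagonal (suc i) (suc j))) (2 ℕ.+ (n ℕ.+ n))
    ≡ K₂ (+ (i ℕ.+ i)) (+ (j ℕ.+ j)) (+ (2 ℕ.+ (n ℕ.+ n)))
  continuant-shift-W₁-diagonal =
    trans (continuant-cong (λ p → W₁-diagonal-threeAt i j (suc p)) (2 ℕ.+ (n ℕ.+ n)))
          (continuant-negThreeAt₂ _ _ _ i+i<j+j j+j≤2+n+n sign-even₂)

lemma8 : (n i j : ℕ) → 2 ≤ n → 1 ≤ i → i < j → j ≤ n →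
    det (W₁ n i j)
      ≡ (+ 4) * (+ n) + (+ 8) * (+ i) * (+ j) - (+ 4) * (+ n) * ((+ i) - (+ j))
        - (+ 4) * ((+ i) * (+ i) + (+ j) * (+ j))
lemma8 (suc (suc n)) (suc i) (suc j) (s≤s (s≤s z≤n)) (s≤s z≤n) (s≤s i<j) (s≤s j≤1+n) = begin
  det (W₁ (2 ℕ.+ n) (suc i) (suc j))
    ≡⟨ det-W₁ n (suc i) (suc j) ⟩
  det (leading (4 ℕ.+ (n ℕ.+ n)) (periodicTridiagonal (4 ℕ.+ (n ℕ.+ n)) d))
    ≡⟨ det-periodicTridiagonal (n ℕ.+ n) d ⟩
  continuant d (4 ℕ.+ (n ℕ.+ n)) + s + s - continuant (shift d) (2 ℕ.+ (n ℕ.+ n))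
    ≡⟨ cong₂ (λ x y → x + s + s - y)
         (continuant-W₁-diagonal n i j i<j j≤1+n) (continuant-shift-W₁-diagonal n i j i<j j≤1+n) ⟩
  K₂ a b k + s + s - K₂ a′ b′ k′
    ≡⟨ cong (λ σ → K₂ a b k + σ + σ - K₂ a′ b′ k′) (cong -_ (sign-even n)) ⟩
  K₂ a b k - + 1 - + 1 - K₂ a′ b′ k′
    ≡⟨ identity (+ n) (+ i) (+ j) ⟩
  _ ∎
  where
  open ≡-Reasoning
  d = W₁-diagonal (suc i) (suc j)
  s = sign (suc (n ℕ.+ n))
  a = + suc (i ℕ.+ i)
  b = + suc (j ℕ.+ j)
  k = + (4 ℕ.+ (n ℕ.+ n))
  a′ = + (i ℕ.+ i)
  b′ = + (j ℕ.+ j)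
  k′ = + (2 ℕ.+ (n ℕ.+ n))
  identity : ∀ n i j →
    K₂ (+ 1 + (i + i)) (+ 1 + (j + j)) (+ 4 + (n + n)) - + 1 - + 1 - K₂ (i + i) (j + j) (+ 2 + (n + n))
      ≡ + 4 * (+ 2 + n) + + 8 * (+ 1 + i) * (+ 1 + j) - + 4 * (+ 2 + n) * ((+ 1 + i) - (+ 1 + j))
        - + 4 * ((+ 1 + i) * (+ 1 + i) + (+ 1 + j) * (+ 1 + j))
  identity = solve-∀
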